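{- Let $q=2^n$ with $n$ a positive integer, let $Y$ be transcendental over $\mathbb{F}_q$, and let $\mathbb{K}=\mathbb{F}_q(Y)$. If $k>0$ is odd, then the polynomial $G(X)=\prod_{w\in\mathbb{F}_q^\times}\left(D_k(wX)-Y\right)\in\mathbb{K}[X]$ has no repeated roots in an algebraic closure $\overline{\mathbb{K}}$ of $\mathbb{K}$.
   Context: The $k$th Dickson polynomial $D_k(x)\in\mathbb{Z}[x]$ is defined by $D_0(x)=2$, $D_1(x)=x$, and $D_k(x)=xD_{k-1}(x)-D_{k-2}(x)$ for $k\ge 2$; it satisfies $D_k(u+1/u)=u^k+u^{ -k}$, and for $k\ge1$ it is monic of degree $k$. Here $D_k$ is viewed as a polynomial over $\mathbb{F}_q$ by reducing coefficients. $\mathbb{F}_q^\times$ denotes the nonzero elements of $\mathbb{F}_q$. -}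

module Defs where

open import Level using (Level; _⊔_; Lift) renaming (suc to lsuc)
open import Algebra.Bundles using (CommutativeRing)
open import Data.Nat as ℕ using (ℕ; zero; suc; _≤_)
open import Data.List using (List; []; _∷_)
open import Data.Fin using (Fin)
import Data.Fin as Fin
open import Data.Sum using (_⊎_)
open import Data.List.Relation.Unary.All using (All)
open import Relation.Binary.PropositionalEquality using (_≡_)
open import Data.Product using (Σ; ∃; _×_; _,_)
open import Relation.Nullary using (¬_)

-- Polynomials over a commutative ring R, as lists of coefficients
-- (constant term first).  Two coefficient lists denote the same polynomial
-- iff all their coefficients agree (missing coefficients are 0).
module PolyOps {c ℓ : Level} (R : CommutativeRing c ℓ) where
  open CommutativeRing R renaming (Carrier to A)

  Poly : Set c
  Poly = List A

  coeff : ℕ → Poly → A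
  coeff _       []       = 0#
  coeff zero    (a ∷ _)  = a
  coeff (suc i) (_ ∷ p)  = coeff i p

  _≈ₚ_ : Poly → Poly → Set ℓ
  p ≈ₚ q = ∀ i → coeff i p ≈ coeff i q

  const : A → Poly
  const a = a ∷ []

  X : Poly
  X = 0# ∷ 1# ∷ []

  _+ₚ_ : Poly → Poly → Poly
  []      +ₚ q       = q
  (a ∷ p) +ₚ []      = a ∷ p
  (a ∷ p) +ₚ (b ∷ q) = (a + b) ∷ (p +ₚ q)

  scale : A → Poly → Poly
  scale a []      = []
  scale a (b ∷ p) = (a * b) ∷ scale a p

  -ₚ_ : Poly → Poly
  -ₚ p = scale (- 1#) p

  _-ₚ_ : Poly → Poly → Poly
  p -ₚ q = p +ₚ (-ₚ q)

  _*ₚ_ : Poly → Poly → Poly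
  []      *ₚ q = []
  (a ∷ p) *ₚ q = scale a q +ₚ (0# ∷ (p *ₚ q))

  eval : Poly → A → A
  eval []      x = 0#
  eval (a ∷ p) x = a + x * eval p x

  -- substitution X ↦ w X, i.e. p(wX): the i-th coefficient gets multiplied by w^i
  substScale : A → Poly → Poly
  substScale w []      = []
  substScale w (a ∷ p) = a ∷ scale w (substScale w p)

  dickson : ℕ → Poly
  dickson zero          = const (1# + 1#)
  dickson (suc zero)    = X
  dickson (suc (suc k)) = (X *ₚ dickson (suc k)) -ₚ dickson k

  prodFin : (m : ℕ) → (Fin m → Poly) → Poly
  prodFin zero    f = const 1#
  prodFin (suc m) f = f Fin.zero *ₚ prodFin m (λ i → f (Fin.suc i))

  RepeatedRoot : Poly → A → Set (c ⊔ ℓ)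
  RepeatedRoot p r =
    ∃ λ (h : Poly) → p ≈ₚ (((X -ₚ const r) *ₚ (X -ₚ const r)) *ₚ h)

record Field (c ℓ : Level) : Set (lsuc (c ⊔ ℓ)) where
  field
    cring : CommutativeRing c ℓ
  open CommutativeRing cring
  field
    1≉0 : ¬ (1# ≈ 0#)
    inverse : ∀ x → ¬ (x ≈ 0#) → ∃ λ y → x * y ≈ 1#

record AlgClosedField (c ℓ : Level) : Set (lsuc (c ⊔ ℓ)) where
  field
    fld : Field c ℓ
  open Field fld public using (cring)
  open CommutativeRing cring
  open PolyOps cring
  field
    closed : ∀ (p : Poly) → (∃ λ i → 1 ≤ i × ¬ (coeff i p ≈ 0#)) →
             ∃ λ r → eval p r ≈ 0#

-- A subfield F of a field L with exactly m elements, presented by an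
-- injective enumeration u : Fin (m ∸ 1) → L of its nonzero elements;
-- F = {0} ∪ image u, required to be closed under the field operations.
module _ {c ℓ : Level} (L : Field c ℓ) where
  open Field L
  open CommutativeRing cring renaming (Carrier to A)

  InSub : ∀ {m} → (Fin m → A) → A → Set ℓ
  InSub u x = (x ≈ 0#) ⊎ (∃ λ i → x ≈ u i)

  record FiniteSubfield (m : ℕ) : Set (c ⊔ ℓ) where
    field
      elems    : Fin (m ℕ.∸ 1) → A
      nonzero  : ∀ i → ¬ (elems i ≈ 0#)
      injective : ∀ i j → elems i ≈ elems j → i ≡ j
      one∈     : InSub elems 1#
      +-closed : ∀ x y → InSub elems x → InSub elems y → InSub elems (x + y)
      neg-closed : ∀ x → InSub elems x → InSub elems (- x)
      *-closed : ∀ x y → InSub elems x → InSub elems y → InSub elems (x * y)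
      inv-closed : ∀ x y → InSub elems x → x * y ≈ 1# → InSub elems y
    Mem : A → Set ℓ
    Mem = InSub elems

  open PolyOps cring

  TranscendentalOver : ∀ {m} → FiniteSubfield m → A → Set (c ⊔ ℓ)
  TranscendentalOver F Y =
    ∀ (p : Poly) → All (FiniteSubfield.Mem F) p → eval p Y ≈ 0# →
    ∀ i → coeff i p ≈ 0#

  dicksonProduct : ∀ {m} → FiniteSubfield m → ℕ → A → Poly
  dicksonProduct {m} F k Y =
    prodFin (m ℕ.∸ 1)
      (λ i → substScale (FiniteSubfield.elems F i) (dickson k) -ₚ const Y)

{-# OPTIONS --safe #-}
-- Since F has 2^n elements, everything happens in characteristic 2.  A repeated
-- root r of G is a double root of one factor D_k(wX) - Y or a common root of two.
-- The first is impossible because X D_k′ = D_k for odd k, which would force Y = 0.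
-- For the second, write w r = u + u⁻¹ and w′ r = v + v⁻¹; then
-- Y = u^k + u⁻ᵏ = v^k + v⁻ᵏ, so after replacing u by u⁻¹ we get v = ζ u with ζ^k = 1,
-- and w (v + v⁻¹) = w′ (u + u⁻¹) expresses u² as a quotient of elements of F(ζ)
-- (w ≠ w′ keeps the denominator nonzero).  Then Y² = u^2k + u^-2k lies in the
-- finite field F(ζ), so Y² and hence Y is fixed by a power x ↦ x^(2^E) of
-- Frobenius, which contradicts the transcendence of Y.
module Submission where

open import Defs
open import Level using (Level)
open import Algebra.Bundles using (CommutativeRing; RawRing)
import Algebra.Solver.Ring.AlmostCommutativeRing as ACR
open import Data.Bool using (Bool; true; false; _xor_; _∧_)
open import Data.Empty using (⊥; ⊥-elim)
open import Data.Fin as Fin using (Fin; toℕ; fromℕ<)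
import Data.Fin.Properties as Fin
open import Data.Fin.Permutation using (Permutation; permutation; _⟨$⟩ʳ_)
open import Data.List using ([]; _∷_)
open import Data.List.Relation.Unary.All using (All; []; _∷_)
open import Data.Maybe using (Maybe; just; nothing)
open import Data.Nat as ℕ using (ℕ; zero; suc; _≤_; s≤s; z≤n; NonZero)
import Data.Nat.Properties as ℕ
open import Data.Nat.DivMod using (m≡m%n+[m/n]*n; m%n<n)
open import Data.Nat.Divisibility using (_∣_; divides; ∣1⇒≡1; ∣-trans)
open import Data.Nat.Coprimality using (Coprime; coprime-+; coprime-divisor)
open import Data.Product using (∃; ∃₂; Σ; _,_; proj₁; proj₂; _×_)
open import Data.Sum using (inj₁; inj₂)
open import Relation.Nullary using (¬_; yes; no)
open import Relation.Nullary.Decidable using (¬¬-excluded-middle)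
open import Relation.Binary.PropositionalEquality as ≡ using (_≡_; _≢_)

module _ where
  open import Data.Nat using (_<_; _+_; _*_; _^_; _∸_; _%_; _/_)
  open import Data.Nat.Properties
  open ≡

  coprime-cancelˡ-^ : ∀ {k q} → Coprime k q → ∀ a {y} → k ∣ q ^ a * y → k ∣ y
  coprime-cancelˡ-^ {k} cop zero {y} k∣y = subst (k ∣_) (+-identityʳ y) k∣y
  coprime-cancelˡ-^ {k} {q} cop (suc a) {y} k∣q^[1+a]y =
    coprime-cancelˡ-^ cop a (coprime-divisor cop (subst (k ∣_) (*-assoc q (q ^ a) y) k∣q^[1+a]y))

  coprime-^ʳ : ∀ {k q} → Coprime k q → ∀ a → Coprime k (q ^ a)
  coprime-^ʳ cop a {i} (i∣k , i∣q^a) = ∣1⇒≡1 (coprime-cancelˡ-^ cop-iq a (subst (i ∣_) (sym (*-identityʳ _)) i∣q^a))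
    where
    cop-iq : Coprime i _
    cop-iq (c∣i , c∣q) = cop (∣-trans c∣i i∣k , c∣q)

  odd-coprime-2 : ∀ j → Coprime (1 + 2 * j) 2
  odd-coprime-2 zero (d∣1 , _) = ∣1⇒≡1 d∣1
  odd-coprime-2 (suc j) = subst (λ m → Coprime m 2) (cong (2 +_) (sym (+-suc j (j + 0)))) (coprime-+ (odd-coprime-2 j))

  %-≡⇒∣∸ : ∀ a b k .{{_ : NonZero k}} → a % k ≡ b % k → k ∣ b ∸ a
  %-≡⇒∣∸ a b k a%k≡b%k = divides (b / k ∸ a / k) (begin
    b ∸ a                                  ≡⟨ cong₂ _∸_ (m≡m%n+[m/n]*n b k) (m≡m%n+[m/n]*n a k) ⟩
    (b % k + b / k * k) ∸ (a % k + a / k * k) ≡⟨ cong (λ r → (r + b / k * k) ∸ (a % k + a / k * k)) (sym a%k≡b%k) ⟩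
    (a % k + b / k * k) ∸ (a % k + a / k * k) ≡⟨ [m+n]∸[m+o]≡n∸o (a % k) (b / k * k) (a / k * k) ⟩
    b / k * k ∸ a / k * k                  ≡⟨ *-distribʳ-∸ k (b / k) (a / k) ⟨
    (b / k ∸ a / k) * k                    ∎)
    where open ≡-Reasoning

  ^-%-collision : ∀ q k → ∃₂ λ a b → a < b × q ^ a % suc k ≡ q ^ b % suc k
  ^-%-collision q k with Fin.pigeonhole (n<1+n (suc k)) (λ i → fromℕ< (m%n<n (q ^ toℕ i) (suc k)))
  ... | i , i′ , i<i′ , same-residue = toℕ i , toℕ i′ , i<i′ , (begin
    q ^ toℕ i % suc k                               ≡⟨ Fin.toℕ-fromℕ< (m%n<n (q ^ toℕ i) (suc k)) ⟨
    toℕ (fromℕ< (m%n<n (q ^ toℕ i) (suc k)))         ≡⟨ cong toℕ same-residue ⟩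
    toℕ (fromℕ< (m%n<n (q ^ toℕ i′) (suc k)))        ≡⟨ Fin.toℕ-fromℕ< (m%n<n (q ^ toℕ i′) (suc k)) ⟩
    q ^ toℕ i′ % suc k                              ∎)
    where open ≡-Reasoning

  ^-≡1-mod : ∀ q k .{{_ : NonZero q}} → Coprime (suc k) q → ∃₂ λ d t → 1 ≤ d × q ^ d ≡ 1 + t * suc k
  ^-≡1-mod q k cop with ^-%-collision q k
  ... | a , b , a<b , same-residue = d , t , m<n⇒0<n∸m a<b , q^d≡1+tk
    where
    d : ℕ
    d = b ∸ a
    q^b∸q^a≡q^a[q^d∸1] : q ^ b ∸ q ^ a ≡ q ^ a * (q ^ d ∸ 1)
    q^b∸q^a≡q^a[q^d∸1] = begin
      q ^ b ∸ q ^ a              ≡⟨ cong (λ e → q ^ e ∸ q ^ a) (sym (m+[n∸m]≡n (<⇒≤ a<b))) ⟩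
      q ^ (a + d) ∸ q ^ a        ≡⟨ cong (_∸ q ^ a) (^-distribˡ-+-* q a d) ⟩
      q ^ a * q ^ d ∸ q ^ a      ≡⟨ cong (q ^ a * q ^ d ∸_) (*-identityʳ (q ^ a)) ⟨
      q ^ a * q ^ d ∸ q ^ a * 1  ≡⟨ *-distribˡ-∸ (q ^ a) (q ^ d) 1 ⟨
      q ^ a * (q ^ d ∸ 1)        ∎
      where open ≡-Reasoning
    k∣q^d∸1 : suc k ∣ q ^ d ∸ 1
    k∣q^d∸1 = coprime-cancelˡ-^ cop a (subst (suc k ∣_) q^b∸q^a≡q^a[q^d∸1] (%-≡⇒∣∸ (q ^ a) (q ^ b) (suc k) same-residue))
    t : ℕ
    t = _∣_.quotient k∣q^d∸1
    q^d≡1+tk : q ^ d ≡ 1 + t * suc k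
    q^d≡1+tk = trans (sym (m+[n∸m]≡n (m^n>0 q d))) (cong (1 +_) (_∣_.equality k∣q^d∸1))

  2^-∸1-odd : ∀ n → 1 ≤ n → ∃ λ t → 2 ^ n ∸ 1 ≡ 1 + 2 * t
  2^-∸1-odd (suc n) _ with 2 ^ n | m^n>0 2 n
  ... | suc p | _ = p , +-suc p (p + 0)

HasCharacteristic2 : ∀ {c ℓ} → CommutativeRing c ℓ → Set ℓ
HasCharacteristic2 R = 1# + 1# ≈ 0#
  where open CommutativeRing R

module FieldProperties {c ℓ : Level} (K : Field c ℓ) where
  open Field K
  open CommutativeRing cring renaming (Carrier to A)
  open import Algebra.Properties.Ring ring using (-‿involutive)
  open import Algebra.Properties.Group +-group using (ε⁻¹≈ε)
  open import Algebra.Properties.Semiring.Exp semiring using (_^_; ^-congˡ)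
  open import Algebra.Properties.CommutativeSemiring.Exp commutativeSemiring using (^-distrib-*)
  open import Relation.Binary.Reasoning.Setoid setoid

  *-cancelˡ : ∀ {a x y} → ¬ a ≈ 0# → a * x ≈ a * y → x ≈ y
  *-cancelˡ {a} {x} {y} a≉0 ax≈ay with inverse a a≉0
  ... | b , ab≈1 = begin
    x             ≈⟨ *-identityˡ x ⟨
    1# * x        ≈⟨ *-congʳ ba≈1 ⟨
    (b * a) * x   ≈⟨ *-assoc b a x ⟩
    b * (a * x)   ≈⟨ *-congˡ ax≈ay ⟩
    b * (a * y)   ≈⟨ *-assoc b a y ⟨
    (b * a) * y   ≈⟨ *-congʳ ba≈1 ⟩
    1# * y        ≈⟨ *-identityˡ y ⟩
    y             ∎
    where
    ba≈1 : b * a ≈ 1#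
    ba≈1 = trans (*-comm b a) ab≈1

  *≈0⇒≈0 : ∀ {a x} → ¬ a ≈ 0# → a * x ≈ 0# → x ≈ 0#
  *≈0⇒≈0 a≉0 ax≈0 = *-cancelˡ a≉0 (trans ax≈0 (sym (zeroʳ _)))

  *-≉0 : ∀ {a b} → ¬ a ≈ 0# → ¬ b ≈ 0# → ¬ a * b ≈ 0#
  *-≉0 a≉0 b≉0 ab≈0 = b≉0 (*≈0⇒≈0 a≉0 ab≈0)

  -1≉0 : ¬ - 1# ≈ 0#
  -1≉0 -1≈0 = 1≉0 (begin
    1#        ≈⟨ -‿involutive 1# ⟨
    - (- 1#)  ≈⟨ -‿cong -1≈0 ⟩
    - 0#      ≈⟨ ε⁻¹≈ε ⟩
    0#        ∎)

  1#^ : ∀ t → 1# ^ t ≈ 1#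
  1#^ zero = refl
  1#^ (suc t) = trans (*-identityˡ _) (1#^ t)

  ^-inverse : ∀ k {a b} → a * b ≈ 1# → a ^ k * b ^ k ≈ 1#
  ^-inverse k {a} {b} ab≈1 = trans (sym (^-distrib-* a b k)) (trans (^-congˡ k ab≈1) (1#^ k))

  *≈1⇒≉0 : ∀ {a b} → a * b ≈ 1# → ¬ a ≈ 0#
  *≈1⇒≉0 {a} {b} ab≈1 a≈0 = 1≉0 (trans (sym ab≈1) (trans (*-congʳ a≈0) (zeroˡ b)))

module FiniteSubfieldProperties {c ℓ : Level} (K : Field c ℓ) {m : ℕ} (F : FiniteSubfield K m) where
  open Field K
  open CommutativeRing cring renaming (Carrier to A)
  open FiniteSubfield F
  open FieldProperties K
  open import Algebra.Properties.Semiring.Exp semiring using (_^_; ^-congʳ; ^-congˡ; ^-assocʳ)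
  open import Algebra.Properties.Ring ring using (-1*x≈-x; -‿involutive)
  open import Relation.Binary.Reasoning.Setoid setoid
  import Algebra.Properties.CommutativeMonoid.Sum *-commutativeMonoid as ∏

  scale-elem : ∀ {a} → Mem a → ¬ a ≈ 0# → ∀ i → ∃ λ j → elems j ≈ a * elems i
  scale-elem {a} a∈F a≉0 i with *-closed a (elems i) a∈F (inj₂ (i , refl))
  ... | inj₁ ax≈0 = ⊥-elim (*-≉0 a≉0 (nonzero i) ax≈0)
  ... | inj₂ (j , ax≈xj) = j , sym ax≈xj

  scale-permutation : ∀ {a} → Mem a → ¬ a ≈ 0# →
    Σ (Permutation (m ℕ.∸ 1) (m ℕ.∸ 1)) λ π → ∀ i → elems (π ⟨$⟩ʳ i) ≈ a * elems i
  scale-permutation {a} a∈F a≉0 with inverse a a≉0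
  ... | b , ab≈1 = permutation σ τ (inverse-of ab≈1 σ-spec τ-spec) (inverse-of (trans (*-comm b a) ab≈1) τ-spec σ-spec) , σ-spec
    where
    b∈F : Mem b
    b∈F = inv-closed a b a∈F ab≈1
    σ τ : Fin (m ℕ.∸ 1) → Fin (m ℕ.∸ 1)
    σ i = proj₁ (scale-elem a∈F a≉0 i)
    τ i = proj₁ (scale-elem b∈F (*≈1⇒≉0 (trans (*-comm b a) ab≈1)) i)
    σ-spec : ∀ i → elems (σ i) ≈ a * elems i
    σ-spec i = proj₂ (scale-elem a∈F a≉0 i)
    τ-spec : ∀ i → elems (τ i) ≈ b * elems i
    τ-spec i = proj₂ (scale-elem b∈F (*≈1⇒≉0 (trans (*-comm b a) ab≈1)) i)
    inverse-of : ∀ {x y} {f g : Fin (m ℕ.∸ 1) → Fin (m ℕ.∸ 1)} → x * y ≈ 1# →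
      (∀ i → elems (f i) ≈ x * elems i) → (∀ i → elems (g i) ≈ y * elems i) → ∀ i → f (g i) ≡ i
    inverse-of {x} {y} {f} {g} xy≈1 f-spec g-spec i = injective _ _ (begin
      elems (f (g i))   ≈⟨ f-spec (g i) ⟩
      x * elems (g i)   ≈⟨ *-congˡ (g-spec i) ⟩
      x * (y * elems i) ≈⟨ *-assoc x y _ ⟨
      (x * y) * elems i ≈⟨ *-congʳ xy≈1 ⟩
      1# * elems i      ≈⟨ *-identityˡ _ ⟩
      elems i           ∎)

  fermat : ∀ {a} → Mem a → ¬ a ≈ 0# → a ^ (m ℕ.∸ 1) ≈ 1#
  fermat {a} a∈F a≉0 with scale-permutation a∈F a≉0
  ... | π , π-spec = *-cancelˡ (∏-≉0 elems nonzero) (begin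
    ∏.sum elems * a ^ (m ℕ.∸ 1)                    ≈⟨ *-comm _ _ ⟩
    a ^ (m ℕ.∸ 1) * ∏.sum elems                    ≈⟨ *-congʳ (∏.sum-replicate (m ℕ.∸ 1)) ⟨
    ∏.sum {m ℕ.∸ 1} (λ _ → a) * ∏.sum elems       ≈⟨ ∏.∑-distrib-+ (λ _ → a) elems ⟨
    ∏.sum (λ i → a * elems i)                      ≈⟨ ∏.sum-cong-≋ π-spec ⟨
    ∏.sum (λ i → elems (π ⟨$⟩ʳ i))                 ≈⟨ ∏.sum-permute elems π ⟨
    ∏.sum elems                                    ≈⟨ *-identityʳ _ ⟨
    ∏.sum elems * 1#                               ∎)
    where
    ∏-≉0 : ∀ {N} (f : Fin N → A) → (∀ i → ¬ f i ≈ 0#) → ¬ ∏.sum f ≈ 0#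
    ∏-≉0 {zero} f f≉0 = 1≉0
    ∏-≉0 {suc N} f f≉0 = *-≉0 (f≉0 Fin.zero) (∏-≉0 (λ i → f (Fin.suc i)) (λ i → f≉0 (Fin.suc i)))

  1≤size : 1 ≤ m
  1≤size with one∈
  ... | inj₁ 1≈0 = ⊥-elim (1≉0 1≈0)
  ... | inj₂ (i , _) = inhabited⇒1≤ m i
    where
    inhabited⇒1≤ : ∀ n → Fin (n ℕ.∸ 1) → 1 ≤ n
    inhabited⇒1≤ (suc n) _ = s≤s z≤n

  ^-size : ∀ {x} → Mem x → x ^ m ≈ x
  ^-size {x} (inj₁ x≈0) = begin
    x ^ m                     ≈⟨ ^-congʳ x (ℕ.m+[n∸m]≡n 1≤size) ⟨
    x * x ^ (m ℕ.∸ 1)         ≈⟨ *-congʳ x≈0 ⟩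
    0# * x ^ (m ℕ.∸ 1)        ≈⟨ zeroˡ _ ⟩
    0#                        ≈⟨ x≈0 ⟨
    x                         ∎
  ^-size {x} (inj₂ (i , x≈xi)) = begin
    x ^ m                     ≈⟨ ^-congʳ x (ℕ.m+[n∸m]≡n 1≤size) ⟨
    x * x ^ (m ℕ.∸ 1)         ≈⟨ *-congˡ (fermat (inj₂ (i , x≈xi)) (λ x≈0 → nonzero i (trans (sym x≈xi) x≈0))) ⟩
    x * 1#                    ≈⟨ *-identityʳ x ⟩
    x                         ∎

  char-2 : (∃ λ t → m ℕ.∸ 1 ≡ 1 ℕ.+ 2 ℕ.* t) → 1# + 1# ≈ 0#
  char-2 (t , m∸1≡1+2t) = begin
    1# + 1#     ≈⟨ +-congʳ -1≈1 ⟨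
    - 1# + 1#   ≈⟨ -‿inverseˡ 1# ⟩
    0#          ∎
    where
    [-1]²≈1 : (- 1#) ^ 2 ≈ 1#
    [-1]²≈1 = begin
      - 1# * (- 1# * 1#)  ≈⟨ *-congˡ (*-identityʳ _) ⟩
      - 1# * - 1#         ≈⟨ -1*x≈-x (- 1#) ⟩
      - (- 1#)            ≈⟨ -‿involutive 1# ⟩
      1#                  ∎
    -1≈1 : - 1# ≈ 1#
    -1≈1 = begin
      - 1#                        ≈⟨ *-identityʳ _ ⟨
      - 1# * 1#                   ≈⟨ *-congˡ (trans (^-congˡ t [-1]²≈1) (1#^ t)) ⟨
      - 1# * ((- 1#) ^ 2) ^ t     ≈⟨ *-congˡ (^-assocʳ (- 1#) 2 t) ⟩
      - 1# * (- 1#) ^ (2 ℕ.* t)   ≈⟨ ^-congʳ (- 1#) m∸1≡1+2t ⟨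
      (- 1#) ^ (m ℕ.∸ 1)          ≈⟨ fermat (neg-closed 1# one∈) -1≉0 ⟩
      1#                          ∎

module Characteristic2 {c ℓ : Level} (R : CommutativeRing c ℓ) (1+1≈0 : HasCharacteristic2 R) where
  open CommutativeRing R renaming (Carrier to A)
  open import Algebra.Properties.Semiring.Exp semiring using (_^_; ^-congʳ; ^-homo-*)
  open import Algebra.Properties.Group +-group using (ε⁻¹≈ε)
  open import Relation.Binary.Reasoning.Setoid setoid
  open PolyOps R

  x+x≈0 : ∀ x → x + x ≈ 0#
  x+x≈0 x = begin
    x + x             ≈⟨ +-cong (*-identityˡ x) (*-identityˡ x) ⟨
    1# * x + 1# * x   ≈⟨ distribʳ x 1# 1# ⟨
    (1# + 1#) * x     ≈⟨ *-congʳ 1+1≈0 ⟩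
    0# * x            ≈⟨ zeroˡ x ⟩
    0#                ∎

  -1≈1 : - 1# ≈ 1#
  -1≈1 = begin
    - 1#                ≈⟨ +-identityʳ (- 1#) ⟨
    - 1# + 0#           ≈⟨ +-congˡ 1+1≈0 ⟨
    - 1# + (1# + 1#)    ≈⟨ +-assoc (- 1#) 1# 1# ⟨
    (- 1# + 1#) + 1#    ≈⟨ +-congʳ (-‿inverseˡ 1#) ⟩
    0# + 1#             ≈⟨ +-identityˡ 1# ⟩
    1#                  ∎

  -- A ring solver with coefficients in 𝔽₂ (Bool under xor and ∧): it
  -- normalises modulo 1 + 1 = 0, hence proves identities of characteristic 2.
  private
    𝔽₂ : RawRing _ _
    𝔽₂ = record { Carrier = Bool ; _≈_ = _≡_ ; _+_ = _xor_ ; _*_ = _∧_ ; -_ = λ b → b ; 0# = false ; 1# = true }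

    ⟦_⟧₂ : Bool → A
    ⟦ false ⟧₂ = 0#
    ⟦ true ⟧₂ = 1#

    ⟦⟧₂-homomorphism : 𝔽₂ ACR.-Raw-AlmostCommutative⟶ ACR.fromCommutativeRing R
    ⟦⟧₂-homomorphism = record
      { ⟦_⟧ = ⟦_⟧₂
      ; +-homo = λ { false false → sym (+-identityˡ 0#) ; false true → sym (+-identityˡ 1#)
                   ; true false → sym (+-identityʳ 1#) ; true true → sym 1+1≈0 }
      ; *-homo = λ { false false → sym (zeroˡ 0#) ; false true → sym (zeroˡ 1#)
                   ; true false → sym (zeroʳ 1#) ; true true → sym (*-identityˡ 1#) }
      ; -‿homo = λ { false → sym ε⁻¹≈ε ; true → sym -1≈1 }
      ; 0-homo = refl
      ; 1-homo = refl
      }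

    ⟦⟧₂-≟ : ∀ a b → Maybe (⟦ a ⟧₂ ≈ ⟦ b ⟧₂)
    ⟦⟧₂-≟ false false = just refl
    ⟦⟧₂-≟ true true = just refl
    ⟦⟧₂-≟ _ _ = nothing

  open import Algebra.Solver.Ring 𝔽₂ (ACR.fromCommutativeRing R) ⟦⟧₂-homomorphism ⟦⟧₂-≟ public

  O I : ∀ {k} → Polynomial k
  O = con false
  I = con true

  +≈0⇒≈ : ∀ {a b} → a + b ≈ 0# → a ≈ b
  +≈0⇒≈ {a} {b} a+b≈0 = begin
    a             ≈⟨ solve 2 (λ a b → a := (a :+ b) :+ b) refl a b ⟩
    (a + b) + b   ≈⟨ +-congʳ a+b≈0 ⟩
    0# + b        ≈⟨ +-identityˡ b ⟩
    b             ∎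

  -- eval′ p x is the derivative p′(x), computed by Horner's rule from (a + X q)′ = q + X q′.
  eval′ : Poly → A → A
  eval′ []      x = 0#
  eval′ (a ∷ p) x = eval p x + x * eval′ p x

  eval-congʳ : ∀ p {x y} → x ≈ y → eval p x ≈ eval p y
  eval-congʳ []      x≈y = refl
  eval-congʳ (a ∷ p) x≈y = +-congˡ (*-cong x≈y (eval-congʳ p x≈y))

  eval-zero : ∀ p x → [] ≈ₚ p → eval p x ≈ 0#
  eval-zero []      x p≈0 = refl
  eval-zero (b ∷ p) x p≈0 = begin
    b + x * eval p x  ≈⟨ +-cong (sym (p≈0 0)) (*-congˡ (eval-zero p x (λ i → p≈0 (suc i)))) ⟩
    0# + x * 0#       ≈⟨ solve 1 (λ x → O :+ x :* O := O) refl x ⟩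
    0#                ∎

  eval-cong : ∀ p q x → p ≈ₚ q → eval p x ≈ eval q x
  eval-cong []      q       x p≈q = sym (eval-zero q x p≈q)
  eval-cong (a ∷ p) []      x p≈q = eval-zero (a ∷ p) x (λ i → sym (p≈q i))
  eval-cong (a ∷ p) (b ∷ q) x p≈q = +-cong (p≈q 0) (*-congˡ (eval-cong p q x (λ i → p≈q (suc i))))

  eval′-zero : ∀ p x → [] ≈ₚ p → eval′ p x ≈ 0#
  eval′-zero []      x p≈0 = refl
  eval′-zero (b ∷ p) x p≈0 = begin
    eval p x + x * eval′ p x ≈⟨ +-cong (eval-zero p x (λ i → p≈0 (suc i))) (*-congˡ (eval′-zero p x (λ i → p≈0 (suc i)))) ⟩
    0# + x * 0#              ≈⟨ solve 1 (λ x → O :+ x :* O := O) refl x ⟩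
    0#                       ∎

  eval′-cong : ∀ p q x → p ≈ₚ q → eval′ p x ≈ eval′ q x
  eval′-cong []      q       x p≈q = sym (eval′-zero q x p≈q)
  eval′-cong (a ∷ p) []      x p≈q = eval′-zero (a ∷ p) x (λ i → sym (p≈q i))
  eval′-cong (a ∷ p) (b ∷ q) x p≈q =
    +-cong (eval-cong p q x (λ i → p≈q (suc i))) (*-congˡ (eval′-cong p q x (λ i → p≈q (suc i))))

  private
    horner-+ : ∀ a b x u v → (a + b) + x * (u + v) ≈ (a + x * u) + (b + x * v)
    horner-+ = solve 5 (λ a b x u v → (a :+ b) :+ x :* (u :+ v) := (a :+ x :* u) :+ (b :+ x :* v)) refl

    horner-scale : ∀ a b x u → a * b + x * (a * u) ≈ a * (b + x * u)
    horner-scale = solve 4 (λ a b x u → a :* b :+ x :* (a :* u) := a :* (b :+ x :* u)) refl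

  eval-+ₚ : ∀ p q x → eval (p +ₚ q) x ≈ eval p x + eval q x
  eval-+ₚ []      q       x = sym (+-identityˡ _)
  eval-+ₚ (a ∷ p) []      x = sym (+-identityʳ _)
  eval-+ₚ (a ∷ p) (b ∷ q) x = begin
    (a + b) + x * eval (p +ₚ q) x            ≈⟨ +-congˡ (*-congˡ (eval-+ₚ p q x)) ⟩
    (a + b) + x * (eval p x + eval q x)      ≈⟨ horner-+ a b x (eval p x) (eval q x) ⟩
    (a + x * eval p x) + (b + x * eval q x)  ∎

  eval′-+ₚ : ∀ p q x → eval′ (p +ₚ q) x ≈ eval′ p x + eval′ q x
  eval′-+ₚ []      q       x = sym (+-identityˡ _)
  eval′-+ₚ (a ∷ p) []      x = sym (+-identityʳ _)
  eval′-+ₚ (a ∷ p) (b ∷ q) x = begin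
    eval (p +ₚ q) x + x * eval′ (p +ₚ q) x           ≈⟨ +-cong (eval-+ₚ p q x) (*-congˡ (eval′-+ₚ p q x)) ⟩
    (eval p x + eval q x) + x * (eval′ p x + eval′ q x)
      ≈⟨ horner-+ (eval p x) (eval q x) x (eval′ p x) (eval′ q x) ⟩
    (eval p x + x * eval′ p x) + (eval q x + x * eval′ q x) ∎

  eval-scale : ∀ a p x → eval (scale a p) x ≈ a * eval p x
  eval-scale a []      x = sym (zeroʳ a)
  eval-scale a (b ∷ p) x = begin
    a * b + x * eval (scale a p) x  ≈⟨ +-congˡ (*-congˡ (eval-scale a p x)) ⟩
    a * b + x * (a * eval p x)      ≈⟨ horner-scale a b x (eval p x) ⟩
    a * (b + x * eval p x)          ∎

  eval′-scale : ∀ a p x → eval′ (scale a p) x ≈ a * eval′ p x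
  eval′-scale a []      x = sym (zeroʳ a)
  eval′-scale a (b ∷ p) x = begin
    eval (scale a p) x + x * eval′ (scale a p) x ≈⟨ +-cong (eval-scale a p x) (*-congˡ (eval′-scale a p x)) ⟩
    a * eval p x + x * (a * eval′ p x)           ≈⟨ horner-scale a (eval p x) x (eval′ p x) ⟩
    a * (eval p x + x * eval′ p x)               ∎

  eval-*ₚ : ∀ p q x → eval (p *ₚ q) x ≈ eval p x * eval q x
  eval-*ₚ []      q x = sym (zeroˡ _)
  eval-*ₚ (a ∷ p) q x = begin
    eval (scale a q +ₚ (0# ∷ (p *ₚ q))) x              ≈⟨ eval-+ₚ (scale a q) (0# ∷ (p *ₚ q)) x ⟩
    eval (scale a q) x + (0# + x * eval (p *ₚ q) x)    ≈⟨ +-cong (eval-scale a q x) (+-congˡ (*-congˡ (eval-*ₚ p q x))) ⟩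
    a * eval q x + (0# + x * (eval p x * eval q x))    ≈⟨ solve 4 (λ a x u v → a :* v :+ (O :+ x :* (u :* v)) := (a :+ x :* u) :* v) refl a x (eval p x) (eval q x) ⟩
    (a + x * eval p x) * eval q x                      ∎

  eval′-*ₚ : ∀ p q x → eval′ (p *ₚ q) x ≈ eval′ p x * eval q x + eval p x * eval′ q x
  eval′-*ₚ []      q x = solve 2 (λ u v → O := O :* u :+ O :* v) refl (eval q x) (eval′ q x)
  eval′-*ₚ (a ∷ p) q x = begin
    eval′ (scale a q +ₚ (0# ∷ (p *ₚ q))) x
      ≈⟨ eval′-+ₚ (scale a q) (0# ∷ (p *ₚ q)) x ⟩
    eval′ (scale a q) x + (eval (p *ₚ q) x + x * eval′ (p *ₚ q) x)
      ≈⟨ +-cong (eval′-scale a q x) (+-cong (eval-*ₚ p q x) (*-congˡ (eval′-*ₚ p q x))) ⟩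
    a * eval′ q x + (eval p x * eval q x + x * (eval′ p x * eval q x + eval p x * eval′ q x))
      ≈⟨ solve 6 (λ a x p p′ q q′ → a :* q′ :+ (p :* q :+ x :* (p′ :* q :+ p :* q′)) := (p :+ x :* p′) :* q :+ (a :+ x :* p) :* q′)
                 refl a x (eval p x) (eval′ p x) (eval q x) (eval′ q x) ⟩
    (eval p x + x * eval′ p x) * eval q x + (a + x * eval p x) * eval′ q x ∎

  eval--ₚ : ∀ p q x → eval (p -ₚ q) x ≈ eval p x + eval q x
  eval--ₚ p q x = begin
    eval (p +ₚ scale (- 1#) q) x        ≈⟨ eval-+ₚ p (scale (- 1#) q) x ⟩
    eval p x + eval (scale (- 1#) q) x  ≈⟨ +-congˡ (eval-scale (- 1#) q x) ⟩
    eval p x + - 1# * eval q x          ≈⟨ solve 2 (λ u v → u :+ (:- I) :* v := u :+ v) refl (eval p x) (eval q x) ⟩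
    eval p x + eval q x                 ∎

  eval′--ₚ : ∀ p q x → eval′ (p -ₚ q) x ≈ eval′ p x + eval′ q x
  eval′--ₚ p q x = begin
    eval′ (p +ₚ scale (- 1#) q) x         ≈⟨ eval′-+ₚ p (scale (- 1#) q) x ⟩
    eval′ p x + eval′ (scale (- 1#) q) x  ≈⟨ +-congˡ (eval′-scale (- 1#) q x) ⟩
    eval′ p x + - 1# * eval′ q x          ≈⟨ solve 2 (λ u v → u :+ (:- I) :* v := u :+ v) refl (eval′ p x) (eval′ q x) ⟩
    eval′ p x + eval′ q x                 ∎

  eval-X : ∀ x → eval X x ≈ x
  eval-X = solve 1 (λ x → O :+ x :* (I :+ x :* O) := x) refl

  eval′-X : ∀ x → eval′ X x ≈ 1#
  eval′-X = solve 1 (λ x → (I :+ x :* O) :+ x :* (O :+ x :* O) := I) refl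

  eval-const : ∀ a x → eval (const a) x ≈ a
  eval-const = solve 2 (λ a x → a :+ x :* O := a) refl

  eval′-const : ∀ a x → eval′ (const a) x ≈ 0#
  eval′-const = solve 2 (λ a x → O :+ x :* O := O) refl

  eval-substScale : ∀ w p x → eval (substScale w p) x ≈ eval p (w * x)
  eval-substScale w []      x = refl
  eval-substScale w (a ∷ p) x = begin
    a + x * eval (scale w (substScale w p)) x ≈⟨ +-congˡ (*-congˡ (eval-scale w (substScale w p) x)) ⟩
    a + x * (w * eval (substScale w p) x)     ≈⟨ +-congˡ (*-congˡ (*-congˡ (eval-substScale w p x))) ⟩
    a + x * (w * eval p (w * x))              ≈⟨ solve 4 (λ a x w u → a :+ x :* (w :* u) := a :+ (w :* x) :* u) refl a x w (eval p (w * x)) ⟩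
    a + (w * x) * eval p (w * x)              ∎

  eval′-substScale : ∀ w p x → eval′ (substScale w p) x ≈ w * eval′ p (w * x)
  eval′-substScale w []      x = sym (zeroʳ w)
  eval′-substScale w (a ∷ p) x = begin
    eval (scale w (substScale w p)) x + x * eval′ (scale w (substScale w p)) x
      ≈⟨ +-cong (eval-scale w (substScale w p) x) (*-congˡ (eval′-scale w (substScale w p) x)) ⟩
    w * eval (substScale w p) x + x * (w * eval′ (substScale w p) x)
      ≈⟨ +-cong (*-congˡ (eval-substScale w p x)) (*-congˡ (*-congˡ (eval′-substScale w p x))) ⟩
    w * eval p (w * x) + x * (w * (w * eval′ p (w * x)))
      ≈⟨ solve 4 (λ x w u v → w :* u :+ x :* (w :* (w :* v)) := w :* (u :+ (w :* x) :* v)) refl x w (eval p (w * x)) (eval′ p (w * x)) ⟩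
    w * (eval p (w * x) + (w * x) * eval′ p (w * x)) ∎

  DoubleZero : Poly → A → Set ℓ
  DoubleZero p r = eval p r ≈ 0# × eval′ p r ≈ 0#

  repeatedRoot⇒doubleZero : ∀ p r → RepeatedRoot p r → DoubleZero p r
  repeatedRoot⇒doubleZero p r (h , p≈[X-r]²h) = eval-≈0 , eval′-≈0
    where
    X-r : Poly
    X-r = X -ₚ const r
    a a′ : A
    a = eval X-r r
    a′ = eval′ X-r r
    a≈0 : a ≈ 0#
    a≈0 = trans (eval--ₚ X (const r) r) (trans (+-cong (eval-X r) (eval-const r r)) (x+x≈0 r))
    eval-≈0 : eval p r ≈ 0#
    eval-≈0 = begin
      eval p r                              ≈⟨ eval-cong p ((X-r *ₚ X-r) *ₚ h) r p≈[X-r]²h ⟩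
      eval ((X-r *ₚ X-r) *ₚ h) r            ≈⟨ eval-*ₚ (X-r *ₚ X-r) h r ⟩
      eval (X-r *ₚ X-r) r * eval h r        ≈⟨ *-congʳ (eval-*ₚ X-r X-r r) ⟩
      (a * a) * eval h r                    ≈⟨ *-congʳ (*-congʳ a≈0) ⟩
      (0# * a) * eval h r                   ≈⟨ solve 2 (λ a u → (O :* a) :* u := O) refl a (eval h r) ⟩
      0#                                    ∎
    eval′-≈0 : eval′ p r ≈ 0#
    eval′-≈0 = begin
      eval′ p r                                   ≈⟨ eval′-cong p ((X-r *ₚ X-r) *ₚ h) r p≈[X-r]²h ⟩
      eval′ ((X-r *ₚ X-r) *ₚ h) r                 ≈⟨ eval′-*ₚ (X-r *ₚ X-r) h r ⟩
      eval′ (X-r *ₚ X-r) r * eval h r + eval (X-r *ₚ X-r) r * eval′ h r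
        ≈⟨ +-cong (*-congʳ (eval′-*ₚ X-r X-r r)) (*-congʳ (eval-*ₚ X-r X-r r)) ⟩
      (a′ * a + a * a′) * eval h r + (a * a) * eval′ h r
        ≈⟨ solve 4 (λ a a′ u v → (a′ :* a :+ a :* a′) :* u :+ (a :* a) :* v := a :* (a :* v)) refl a a′ (eval h r) (eval′ h r) ⟩
      a * (a * eval′ h r)                         ≈⟨ *-congʳ a≈0 ⟩
      0# * (a * eval′ h r)                        ≈⟨ zeroˡ _ ⟩
      0#                                          ∎

  eval-dickson-rec : ∀ k z → eval (dickson (2 ℕ.+ k)) z ≈ z * eval (dickson (1 ℕ.+ k)) z + eval (dickson k) z
  eval-dickson-rec k z = begin
    eval ((X *ₚ dickson (suc k)) -ₚ dickson k) z               ≈⟨ eval--ₚ (X *ₚ dickson (suc k)) (dickson k) z ⟩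
    eval (X *ₚ dickson (suc k)) z + eval (dickson k) z         ≈⟨ +-congʳ (eval-*ₚ X (dickson (suc k)) z) ⟩
    eval X z * eval (dickson (suc k)) z + eval (dickson k) z   ≈⟨ +-congʳ (*-congʳ (eval-X z)) ⟩
    z * eval (dickson (suc k)) z + eval (dickson k) z          ∎

  eval′-dickson-rec : ∀ k z → eval′ (dickson (2 ℕ.+ k)) z ≈
    (eval (dickson (1 ℕ.+ k)) z + z * eval′ (dickson (1 ℕ.+ k)) z) + eval′ (dickson k) z
  eval′-dickson-rec k z = begin
    eval′ ((X *ₚ D₁₊ₖ) -ₚ dickson k) z                         ≈⟨ eval′--ₚ (X *ₚ D₁₊ₖ) (dickson k) z ⟩
    eval′ (X *ₚ D₁₊ₖ) z + eval′ (dickson k) z                  ≈⟨ +-congʳ (eval′-*ₚ X D₁₊ₖ z) ⟩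
    (eval′ X z * eval D₁₊ₖ z + eval X z * eval′ D₁₊ₖ z) + eval′ (dickson k) z
      ≈⟨ +-congʳ (+-cong (trans (*-congʳ (eval′-X z)) (*-identityˡ _)) (*-congʳ (eval-X z))) ⟩
    (eval D₁₊ₖ z + z * eval′ D₁₊ₖ z) + eval′ (dickson k) z     ∎
    where
    D₁₊ₖ : Poly
    D₁₊ₖ = dickson (suc k)

  eval-dickson-+ : ∀ k {u v} → u * v ≈ 1# → eval (dickson k) (u + v) ≈ u ^ k + v ^ k
  eval-dickson-+ k {u} {v} uv≈1 = proj₁ (consecutive k)
    where
    consecutive : ∀ k → (eval (dickson k) (u + v) ≈ u ^ k + v ^ k) × (eval (dickson (suc k)) (u + v) ≈ u ^ suc k + v ^ suc k)
    consecutive zero =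
      solve 2 (λ u v → (I :+ I) :+ (u :+ v) :* O := I :+ I) refl u v ,
      solve 2 (λ u v → O :+ (u :+ v) :* (I :+ (u :+ v) :* O) := u :* I :+ v :* I) refl u v
    consecutive (suc k) = proj₂ ih , (begin
      eval (dickson (2 ℕ.+ k)) (u + v)                                 ≈⟨ eval-dickson-rec k (u + v) ⟩
      (u + v) * eval (dickson (suc k)) (u + v) + eval (dickson k) (u + v) ≈⟨ +-cong (*-congˡ (proj₂ ih)) (proj₁ ih) ⟩
      (u + v) * (u * u ^ k + v * v ^ k) + (u ^ k + v ^ k)
        ≈⟨ solve 4 (λ u v a b → (u :+ v) :* (u :* a :+ v :* b) :+ (a :+ b)
                               := (u :* (u :* a) :+ v :* (v :* b)) :+ (u :* v :+ I) :* (a :+ b))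
                   refl u v (u ^ k) (v ^ k) ⟩
      (u * (u * u ^ k) + v * (v * v ^ k)) + (u * v + 1#) * (u ^ k + v ^ k)
        ≈⟨ +-congˡ (*-congʳ (+-congʳ uv≈1)) ⟩
      (u * (u * u ^ k) + v * (v * v ^ k)) + (1# + 1#) * (u ^ k + v ^ k)
        ≈⟨ solve 3 (λ a b c → (a :+ b) :+ (I :+ I) :* c := a :+ b) refl (u * (u * u ^ k)) (v * (v * v ^ k)) (u ^ k + v ^ k) ⟩
      u * (u * u ^ k) + v * (v * v ^ k)                                ∎)
      where
      ih : (eval (dickson k) (u + v) ≈ u ^ k + v ^ k) × (eval (dickson (suc k)) (u + v) ≈ u ^ suc k + v ^ suc k)
      ih = consecutive k

  eval′-dickson-parity : ∀ j z → eval′ (dickson (2 ℕ.* j)) z ≈ 0# ×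
                             z * eval′ (dickson (1 ℕ.+ 2 ℕ.* j)) z ≈ eval (dickson (1 ℕ.+ 2 ℕ.* j)) z
  eval′-dickson-parity zero z = solve 1 (λ z → O :+ z :* O := O) refl z , (begin
    z * eval′ X z  ≈⟨ *-congˡ (eval′-X z) ⟩
    z * 1#         ≈⟨ *-identityʳ z ⟩
    z              ≈⟨ eval-X z ⟨
    eval X z       ∎)
  eval′-dickson-parity (suc j) z =
    ≡.subst (λ i → eval′ (dickson i) z ≈ 0# × z * eval′ (dickson (suc i)) z ≈ eval (dickson (suc i)) z)
      (≡.sym (ℕ.*-suc 2 j)) (D′₂₊ₖ≈0 , zD′₃₊ₖ≈D₃₊ₖ)
    where
    D D′ : ℕ → A
    D i = eval (dickson i) z
    D′ i = eval′ (dickson i) z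
    k : ℕ
    k = 2 ℕ.* j
    ih : D′ k ≈ 0# × z * D′ (suc k) ≈ D (suc k)
    ih = eval′-dickson-parity j z
    D′₂₊ₖ≈0 : D′ (2 ℕ.+ k) ≈ 0#
    D′₂₊ₖ≈0 = begin
      D′ (2 ℕ.+ k)                                   ≈⟨ eval′-dickson-rec k z ⟩
      (D (suc k) + z * D′ (suc k)) + D′ k           ≈⟨ +-cong (+-congˡ (proj₂ ih)) (proj₁ ih) ⟩
      (D (suc k) + D (suc k)) + 0#                  ≈⟨ solve 1 (λ a → (a :+ a) :+ O := O) refl (D (suc k)) ⟩
      0#                                            ∎
    zD′₃₊ₖ≈D₃₊ₖ : z * D′ (3 ℕ.+ k) ≈ D (3 ℕ.+ k)
    zD′₃₊ₖ≈D₃₊ₖ = begin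
      z * D′ (3 ℕ.+ k)                                  ≈⟨ *-congˡ (eval′-dickson-rec (suc k) z) ⟩
      z * ((D (2 ℕ.+ k) + z * D′ (2 ℕ.+ k)) + D′ (suc k))
        ≈⟨ solve 4 (λ z a b c → z :* ((a :+ z :* b) :+ c) := z :* a :+ z :* z :* b :+ z :* c)
                   refl z (D (2 ℕ.+ k)) (D′ (2 ℕ.+ k)) (D′ (suc k)) ⟩
      z * D (2 ℕ.+ k) + z * z * D′ (2 ℕ.+ k) + z * D′ (suc k)  ≈⟨ +-cong (+-congˡ (*-congˡ D′₂₊ₖ≈0)) (proj₂ ih) ⟩
      z * D (2 ℕ.+ k) + z * z * 0# + D (suc k)                ≈⟨ solve 3 (λ z a b → z :* a :+ z :* z :* O :+ b := z :* a :+ b) refl z (D (2 ℕ.+ k)) (D (suc k)) ⟩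
      z * D (2 ℕ.+ k) + D (suc k)                            ≈⟨ eval-dickson-rec (suc k) z ⟨
      D (3 ℕ.+ k)                                            ∎

  -- Iterated squaring rather than x ^ (2 ^ e) (see frob≈^), so that frob-+ is a direct induction.
  frob : ℕ → A → A
  frob zero    x = x
  frob (suc e) x = frob e x * frob e x

  frob-cong : ∀ e {x y} → x ≈ y → frob e x ≈ frob e y
  frob-cong zero    x≈y = x≈y
  frob-cong (suc e) x≈y = *-cong (frob-cong e x≈y) (frob-cong e x≈y)

  frob-+ : ∀ e x y → frob e (x + y) ≈ frob e x + frob e y
  frob-+ zero    x y = refl
  frob-+ (suc e) x y = trans (*-cong (frob-+ e x y) (frob-+ e x y))
    (solve 2 (λ a b → (a :+ b) :* (a :+ b) := a :* a :+ b :* b) refl (frob e x) (frob e y))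

  frob-* : ∀ e x y → frob e (x * y) ≈ frob e x * frob e y
  frob-* zero    x y = refl
  frob-* (suc e) x y = trans (*-cong (frob-* e x y) (frob-* e x y))
    (solve 2 (λ a b → (a :* b) :* (a :* b) := (a :* a) :* (b :* b)) refl (frob e x) (frob e y))

  frob-1 : ∀ e → frob e 1# ≈ 1#
  frob-1 zero    = refl
  frob-1 (suc e) = trans (*-cong (frob-1 e) (frob-1 e)) (*-identityˡ 1#)

  frob-^ : ∀ e x k → frob e (x ^ k) ≈ frob e x ^ k
  frob-^ e x zero    = frob-1 e
  frob-^ e x (suc k) = trans (frob-* e x (x ^ k)) (*-congˡ (frob-^ e x k))

  frob-+ℕ : ∀ a b x → frob (a ℕ.+ b) x ≈ frob a (frob b x)
  frob-+ℕ zero    b x = refl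
  frob-+ℕ (suc a) b x = *-cong (frob-+ℕ a b x) (frob-+ℕ a b x)

  frob≈^ : ∀ e x → frob e x ≈ x ^ (2 ℕ.^ e)
  frob≈^ zero    x = sym (*-identityʳ x)
  frob≈^ (suc e) x = begin
    frob e x * frob e x                    ≈⟨ *-cong (frob≈^ e x) (frob≈^ e x) ⟩
    x ^ (2 ℕ.^ e) * x ^ (2 ℕ.^ e)          ≈⟨ ^-homo-* x (2 ℕ.^ e) (2 ℕ.^ e) ⟨
    x ^ (2 ℕ.^ e ℕ.+ 2 ℕ.^ e)              ≈⟨ ^-congʳ x (≡.cong (2 ℕ.^ e ℕ.+_) (≡.sym (ℕ.+-identityʳ (2 ℕ.^ e)))) ⟩
    x ^ (2 ℕ.^ suc e)                      ∎

module Characteristic2Field {c ℓ : Level} (K : Field c ℓ) (1+1≈0 : HasCharacteristic2 (Field.cring K)) where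
  open Field K
  open CommutativeRing cring renaming (Carrier to A)
  open FieldProperties K
  open Characteristic2 cring 1+1≈0
  open PolyOps cring
  open import Algebra.Properties.Semiring.Exp semiring using (_^_; ^-congˡ)
  open import Relation.Binary.Reasoning.Setoid setoid

  eval-prodFin-≉0 : ∀ m (f : Fin m → Poly) r → (∀ i → ¬ eval (f i) r ≈ 0#) → ¬ eval (prodFin m f) r ≈ 0#
  eval-prodFin-≉0 zero    f r _     P≈0 = 1≉0 (trans (sym (eval-const 1# r)) P≈0)
  eval-prodFin-≉0 (suc m) f r f≉0 P≈0 =
    eval-prodFin-≉0 m (λ i → f (Fin.suc i)) r (λ i → f≉0 (Fin.suc i))
      (*≈0⇒≈0 (f≉0 Fin.zero) (trans (sym (eval-*ₚ (f Fin.zero) _ r)) P≈0))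

  prodFin-doubleZero : ∀ m (f : Fin m → Poly) r →
    (∀ i → ¬ DoubleZero (f i) r) →
    (∀ i j → i ≢ j → eval (f i) r ≈ 0# → ¬ eval (f j) r ≈ 0#) →
    ¬ DoubleZero (prodFin m f) r
  prodFin-doubleZero zero    f r _ _ (P≈0 , _) = eval-prodFin-≉0 0 f r (λ ()) P≈0
  prodFin-doubleZero (suc m) f r simple disjoint (P≈0 , P′≈0) = ¬¬-excluded-middle λ
    { (yes f₀≈0) → ¬¬-excluded-middle λ
        { (yes f₀′≈0) → simple Fin.zero (f₀≈0 , f₀′≈0)
        ; (no f₀′≉0) → eval-prodFin-≉0 m tail r (λ i → disjoint Fin.zero (Fin.suc i) (λ ()) f₀≈0)
                         (*≈0⇒≈0 f₀′≉0 (f₀′Q≈0 f₀≈0)) }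
    ; (no f₀≉0) → prodFin-doubleZero m tail r (λ i → simple (Fin.suc i))
                    (λ i j i≢j → disjoint (Fin.suc i) (Fin.suc j) (λ eq → i≢j (Fin.suc-injective eq)))
                    (Q≈0 f₀≉0 , *≈0⇒≈0 f₀≉0 (f₀Q′≈0 f₀≉0)) }
    where
    f₀ Q : Poly
    f₀ = f Fin.zero
    tail : Fin m → Poly
    tail i = f (Fin.suc i)
    Q = prodFin m tail
    leibniz : eval′ f₀ r * eval Q r + eval f₀ r * eval′ Q r ≈ 0#
    leibniz = trans (sym (eval′-*ₚ f₀ Q r)) P′≈0
    Q≈0 : ¬ eval f₀ r ≈ 0# → eval Q r ≈ 0#
    Q≈0 f₀≉0 = *≈0⇒≈0 f₀≉0 (trans (sym (eval-*ₚ f₀ Q r)) P≈0)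
    f₀′Q≈0 : eval f₀ r ≈ 0# → eval′ f₀ r * eval Q r ≈ 0#
    f₀′Q≈0 f₀≈0 = begin
      eval′ f₀ r * eval Q r                             ≈⟨ +-identityʳ _ ⟨
      eval′ f₀ r * eval Q r + 0#                        ≈⟨ +-congˡ (trans (*-congʳ f₀≈0) (zeroˡ _)) ⟨
      eval′ f₀ r * eval Q r + eval f₀ r * eval′ Q r     ≈⟨ leibniz ⟩
      0#                                                ∎
    f₀Q′≈0 : ¬ eval f₀ r ≈ 0# → eval f₀ r * eval′ Q r ≈ 0#
    f₀Q′≈0 f₀≉0 = begin
      eval f₀ r * eval′ Q r                             ≈⟨ +-identityˡ _ ⟨
      0# + eval f₀ r * eval′ Q r                        ≈⟨ +-congʳ (trans (*-congˡ (Q≈0 f₀≉0)) (zeroʳ _)) ⟨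
      eval′ f₀ r * eval Q r + eval f₀ r * eval′ Q r     ≈⟨ leibniz ⟩
      0#                                                ∎

  square-injective : ∀ {x y} → x * x ≈ y * y → ¬ ¬ x ≈ y
  square-injective {x} {y} xx≈yy x≉y = ¬¬-excluded-middle λ
    { (yes x+y≈0) → x≉y (+≈0⇒≈ x+y≈0)
    ; (no x+y≉0) → x+y≉0 (*≈0⇒≈0 x+y≉0 (begin
        (x + y) * (x + y)   ≈⟨ solve 2 (λ x y → (x :+ y) :* (x :+ y) := x :* x :+ y :* y) refl x y ⟩
        x * x + y * y       ≈⟨ +-congʳ xx≈yy ⟩
        y * y + y * y       ≈⟨ x+x≈0 (y * y) ⟩
        0#                  ∎)) }

  frob-fixed-*ℕ : ∀ {e x} d → frob e x ≈ x → frob (d ℕ.* e) x ≈ x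
  frob-fixed-*ℕ         zero    fx = refl
  frob-fixed-*ℕ {e} {x} (suc d) fx = trans (frob-+ℕ e (d ℕ.* e) x) (trans (frob-cong e (frob-fixed-*ℕ d fx)) fx)

  module FixedBy (e : ℕ) where

    Fixed : A → Set ℓ
    Fixed x = frob e x ≈ x

    fixed-cong : ∀ {x y} → x ≈ y → Fixed x → Fixed y
    fixed-cong x≈y fx = trans (frob-cong e (sym x≈y)) (trans fx x≈y)

    fixed-+ : ∀ {x y} → Fixed x → Fixed y → Fixed (x + y)
    fixed-+ {x} {y} fx fy = trans (frob-+ e x y) (+-cong fx fy)

    fixed-* : ∀ {x y} → Fixed x → Fixed y → Fixed (x * y)
    fixed-* {x} {y} fx fy = trans (frob-* e x y) (*-cong fx fy)

    fixed-^ : ∀ {x} k → Fixed x → Fixed (x ^ k)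
    fixed-^ {x} k fx = trans (frob-^ e x k) (^-congˡ k fx)

    fixed-quotient : ∀ {a b s} → ¬ a ≈ 0# → a * s ≈ b → Fixed a → Fixed b → Fixed s
    fixed-quotient {a} {b} {s} a≉0 as≈b fa fb = *-cancelˡ a≉0 (begin
      a * frob e s        ≈⟨ *-congʳ fa ⟨
      frob e a * frob e s ≈⟨ frob-* e a s ⟨
      frob e (a * s)      ≈⟨ frob-cong e as≈b ⟩
      frob e b            ≈⟨ fb ⟩
      b                   ≈⟨ as≈b ⟨
      a * s               ∎)

    fixed-inverse : ∀ {a b} → a * b ≈ 1# → Fixed a → Fixed b
    fixed-inverse ab≈1 fa = fixed-quotient (*≈1⇒≉0 ab≈1) ab≈1 fa (frob-1 e)

    fixed-square : ∀ {x} → Fixed (x * x) → ¬ ¬ Fixed x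
    fixed-square {x} fxx = square-injective (trans (sym (frob-* e x x)) fxx)

module DicksonProduct {c ℓ : Level} (L : AlgClosedField c ℓ) {n : ℕ} (1≤n : 1 ℕ.≤ n)
                      (F : FiniteSubfield (AlgClosedField.fld L) (2 ℕ.^ n))
                      (Y : CommutativeRing.Carrier (AlgClosedField.cring L))
                      (Y-transcendental : TranscendentalOver (AlgClosedField.fld L) F Y) (j : ℕ) where
  open AlgClosedField L
  open CommutativeRing cring renaming (Carrier to A)
  open Field fld using (1≉0)
  open FiniteSubfield F
  open FieldProperties fld
  open FiniteSubfieldProperties fld F using (^-size; char-2)
  open PolyOps cring
  open import Algebra.Properties.Semiring.Exp semiring using (_^_; ^-congˡ; ^-congʳ; ^-assocʳ)
  open import Algebra.Properties.CommutativeSemiring.Exp commutativeSemiring using (^-distrib-*)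
  open import Relation.Binary.Reasoning.Setoid setoid

  1+1≈0 : 1# + 1# ≈ 0#
  1+1≈0 = char-2 (2^-∸1-odd n 1≤n)

  open Characteristic2 cring 1+1≈0
  open Characteristic2Field fld 1+1≈0

  k : ℕ
  k = 1 ℕ.+ 2 ℕ.* j

  D D′ : A → A
  D = eval (dickson k)
  D′ = eval′ (dickson k)

  factor : Fin (2 ℕ.^ n ℕ.∸ 1) → Poly
  factor i = substScale (elems i) (dickson k) -ₚ const Y

  monomial : ℕ → Poly
  monomial zero    = 1# ∷ []
  monomial (suc i) = 0# ∷ monomial i

  Y≉0 : ¬ Y ≈ 0#
  Y≉0 Y≈0 = 1≉0 (Y-transcendental X (inj₁ refl ∷ one∈ ∷ []) (trans (eval-X Y) Y≈0) 1)

  Y^≉Y : ∀ m → 2 ≤ m → ¬ Y ^ m ≈ Y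
  Y^≉Y 1 (s≤s ())
  Y^≉Y (suc (suc i)) _ Y^m≈Y = 1≉0 (Y-transcendental (0# ∷ 1# ∷ monomial i) (inj₁ refl ∷ one∈ ∷ monomial-∈F i) Y+Y^m≈0 1)
    where
    monomial-∈F : ∀ i → All Mem (monomial i)
    monomial-∈F zero    = one∈ ∷ []
    monomial-∈F (suc i) = inj₁ refl ∷ monomial-∈F i
    eval-monomial : ∀ i x → eval (monomial i) x ≈ x ^ i
    eval-monomial zero    x = solve 1 (λ x → I :+ x :* O := I) refl x
    eval-monomial (suc i) x = trans (+-identityˡ _) (*-congˡ (eval-monomial i x))
    Y+Y^m≈0 : eval (0# ∷ 1# ∷ monomial i) Y ≈ 0#
    Y+Y^m≈0 = begin
      0# + Y * (1# + Y * eval (monomial i) Y) ≈⟨ +-congˡ (*-congˡ (+-congˡ (*-congˡ (eval-monomial i Y)))) ⟩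
      0# + Y * (1# + Y * Y ^ i)               ≈⟨ solve 2 (λ y q → O :+ y :* (I :+ y :* q) := y :+ y :* (y :* q)) refl Y (Y ^ i) ⟩
      Y + Y ^ suc (suc i)                     ≈⟨ +-congˡ Y^m≈Y ⟩
      Y + Y                                   ≈⟨ x+x≈0 Y ⟩
      0#                                      ∎

  Y-not-fixed : ∀ e → 1 ≤ e → ¬ frob e Y ≈ Y
  Y-not-fixed e 1≤e fY = Y^≉Y (2 ℕ.^ e) (ℕ.^-monoʳ-≤ 2 1≤e) (trans (sym (frob≈^ e Y)) fY)

  eval-factor : ∀ i r → eval (factor i) r ≈ D (elems i * r) + Y
  eval-factor i r = trans (eval--ₚ (substScale (elems i) (dickson k)) (const Y) r)
                          (+-cong (eval-substScale (elems i) (dickson k) r) (eval-const Y r))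

  eval′-factor : ∀ i r → eval′ (factor i) r ≈ elems i * D′ (elems i * r)
  eval′-factor i r = trans (eval′--ₚ (substScale (elems i) (dickson k)) (const Y) r)
                           (trans (+-cong (eval′-substScale (elems i) (dickson k) r) (eval′-const Y r)) (+-identityʳ _))

  factor-zero : ∀ {i r} → eval (factor i) r ≈ 0# → D (elems i * r) ≈ Y
  factor-zero {i} {r} f≈0 = +≈0⇒≈ (trans (sym (eval-factor i r)) f≈0)

  factor-simple : ∀ i r → ¬ DoubleZero (factor i) r
  factor-simple i r (f≈0 , f′≈0) = Y≉0 (begin
    Y                          ≈⟨ factor-zero f≈0 ⟨
    D z                        ≈⟨ proj₂ (eval′-dickson-parity j z) ⟨
    z * D′ z                   ≈⟨ *-congˡ D′≈0 ⟩
    z * 0#                     ≈⟨ zeroʳ z ⟩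
    0#                         ∎)
    where
    z : A
    z = elems i * r
    D′≈0 : D′ z ≈ 0#
    D′≈0 = *≈0⇒≈0 (nonzero i) (trans (sym (eval′-factor i r)) f′≈0)

  -- u is a root of X² + x X + 1, so that x = u + u⁻¹ with u⁻¹ = x + u.
  ∃-u+u⁻¹ : ∀ x → ∃ λ u → u * (x + u) ≈ 1#
  ∃-u+u⁻¹ x with closed (1# ∷ x ∷ 1# ∷ []) (2 , s≤s z≤n , 1≉0)
  ... | u , root = u , sym (+≈0⇒≈ (trans (solve 2 (λ x u → I :+ u :* (x :+ u) := I :+ u :* (x :+ u :* (I :+ u :* O))) refl x u) root))

  factor-zero-split : ∀ {i r u u′} → eval (factor i) r ≈ 0# → u * u′ ≈ 1# → u + u′ ≈ elems i * r → Y ≈ u ^ k + u′ ^ k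
  factor-zero-split {i} {r} {u} {u′} f≈0 uu′≈1 u+u′≈x = begin
    Y                  ≈⟨ factor-zero f≈0 ⟨
    D (elems i * r)    ≈⟨ eval-congʳ (dickson k) u+u′≈x ⟨
    D (u + u′)         ≈⟨ eval-dickson-+ k uu′≈1 ⟩
    u ^ k + u′ ^ k     ∎

  order : ∃₂ λ d t → 1 ≤ d × (2 ℕ.^ n) ℕ.^ d ≡ 1 ℕ.+ t ℕ.* k
  order = ^-≡1-mod (2 ℕ.^ n) (2 ℕ.* j) {{ℕ.m^n≢0 2 n}} (coprime-^ʳ (odd-coprime-2 j) n)

  -- frob E fixes F pointwise (n ∣ E) and every k-th root of unity (2^E ≡ 1 mod k).
  E : ℕ
  E = proj₁ order ℕ.* n

  1≤E : 1 ≤ E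
  1≤E = ℕ.*-mono-≤ (proj₁ (proj₂ (proj₂ order))) 1≤n

  open FixedBy E

  fixed-∈F : ∀ {x} → Mem x → Fixed x
  fixed-∈F {x} x∈F = frob-fixed-*ℕ (proj₁ order) (trans (frob≈^ n x) (^-size x∈F))

  fixed-unity : ∀ {ζ} → ζ ^ k ≈ 1# → Fixed ζ
  fixed-unity {ζ} ζ^k≈1 = begin
    frob E ζ            ≈⟨ frob≈^ E ζ ⟩
    ζ ^ (2 ℕ.^ E)       ≈⟨ ^-congʳ ζ 2^E≡1+tk ⟩
    ζ * ζ ^ (t ℕ.* k)   ≈⟨ *-congˡ (^-congʳ ζ (ℕ.*-comm t k)) ⟩
    ζ * ζ ^ (k ℕ.* t)   ≈⟨ *-congˡ (^-assocʳ ζ k t) ⟨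
    ζ * (ζ ^ k) ^ t     ≈⟨ *-congˡ (trans (^-congˡ t ζ^k≈1) (1#^ t)) ⟩
    ζ * 1#              ≈⟨ *-identityʳ ζ ⟩
    ζ                   ∎
    where
    d t : ℕ
    d = proj₁ order
    t = proj₁ (proj₂ order)
    2^E≡1+tk : 2 ℕ.^ E ≡ 1 ℕ.+ t ℕ.* k
    2^E≡1+tk = ≡.trans (≡.cong (2 ℕ.^_) (ℕ.*-comm d n)) (≡.trans (≡.sym (ℕ.^-*-assoc 2 n d)) (proj₂ (proj₂ (proj₂ order))))

  -- w (v + v′) = w w′ r = w′ (u + u′); multiply by u and use u u′ = 1.
  u²-equation : ∀ {i i′ r u u′ v v′} → u * u′ ≈ 1# → u + u′ ≈ elems i * r → v + v′ ≈ elems i′ * r →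
                (elems i′ + elems i * (v * u′)) * (u * u) ≈ elems i * (u * v′) + elems i′
  u²-equation {i} {i′} {r} {u} {u′} {v} {v′} uu′≈1 u+u′≈x v+v′≈x′ = +≈0⇒≈ (begin
    (w′ + w * (v * u′)) * (u * u) + (w * (u * v′) + w′)
      ≈⟨ solve 6 (λ w w′ u u′ v v′ → (w′ :+ w :* (v :* u′)) :* (u :* u) :+ (w :* (u :* v′) :+ w′)
                   := u :* (w :* (v :+ v′) :+ w′ :* (u :+ u′)) :+ (u :* u′ :+ I) :* (w :* v :* u :+ w′))
                 refl w w′ u u′ v v′ ⟩
    u * (w * (v + v′) + w′ * (u + u′)) + (u * u′ + 1#) * (w * v * u + w′)
      ≈⟨ +-cong (*-congˡ (+-cong (*-congˡ v+v′≈x′) (*-congˡ u+u′≈x))) (*-congʳ (+-congʳ uu′≈1)) ⟩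
    u * (w * (w′ * r) + w′ * (w * r)) + (1# + 1#) * (w * v * u + w′)
      ≈⟨ solve 5 (λ w w′ r u c → u :* (w :* (w′ :* r) :+ w′ :* (w :* r)) :+ (I :+ I) :* c := O) refl w w′ r u (w * v * u + w′) ⟩
    0#                   ∎)
    where
    w w′ : A
    w = elems i
    w′ = elems i′

  distinct-unit-ratio : ∀ {i i′ ζ ζ′} → i ≢ i′ → ζ * ζ′ ≈ 1# →
                        elems i′ + elems i * ζ ≈ 0# → ¬ elems i * ζ′ + elems i′ ≈ 0#
  distinct-unit-ratio {i} {i′} {ζ} {ζ′} i≢i′ ζζ′≈1 a≈0 b≈0 = square-injective ζζ≈1·1 λ ζ≈1 → i≢i′ (injective i i′ (begin
    w          ≈⟨ *-identityʳ w ⟨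
    w * 1#     ≈⟨ *-congˡ ζ≈1 ⟨
    w * ζ      ≈⟨ wζ≈w′ ⟩
    w′         ∎))
    where
    w w′ : A
    w = elems i
    w′ = elems i′
    wζ≈w′ : w * ζ ≈ w′
    wζ≈w′ = +≈0⇒≈ (trans (+-comm _ _) a≈0)
    ζζ≈1·1 : ζ * ζ ≈ 1# * 1#
    ζζ≈1·1 = trans (*-congˡ (*-cancelˡ (nonzero i) (trans wζ≈w′ (sym (+≈0⇒≈ b≈0))))) (trans ζζ′≈1 (sym (*-identityˡ 1#)))

  aligned-common-zero⇒⊥ : ∀ {i i′ r u u′ v v′} → i ≢ i′ →
    u * u′ ≈ 1# → u + u′ ≈ elems i * r → v * v′ ≈ 1# → v + v′ ≈ elems i′ * r →
    Y ≈ u ^ k + u′ ^ k → v ^ k ≈ u ^ k → ⊥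
  aligned-common-zero⇒⊥ {i} {i′} {r} {u} {u′} {v} {v′} i≢i′ uu′≈1 u+u′≈x vv′≈1 v+v′≈x′ Y≈u^k+u′^k v^k≈u^k =
    fixed-square (fixed-cong (sym Y²≈s^k+s′^k) (fixed-+ (fixed-^ k s-fixed) (fixed-^ k s′-fixed))) (Y-not-fixed E 1≤E)
    where
    w w′ ζ ζ′ s s′ : A
    w = elems i
    w′ = elems i′
    -- v = ζ u and v′ = ζ′ u′
    ζ = v * u′
    ζ′ = u * v′
    s = u * u
    s′ = u′ * u′
    ζζ′≈1 : ζ * ζ′ ≈ 1#
    ζζ′≈1 = begin
      (v * u′) * (u * v′)  ≈⟨ solve 4 (λ u u′ v v′ → (v :* u′) :* (u :* v′) := (u :* u′) :* (v :* v′)) refl u u′ v v′ ⟩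
      (u * u′) * (v * v′)  ≈⟨ *-cong uu′≈1 vv′≈1 ⟩
      1# * 1#              ≈⟨ *-identityˡ 1# ⟩
      1#                   ∎
    ζ^k≈1 : ζ ^ k ≈ 1#
    ζ^k≈1 = begin
      (v * u′) ^ k     ≈⟨ ^-distrib-* v u′ k ⟩
      v ^ k * u′ ^ k   ≈⟨ *-congʳ v^k≈u^k ⟩
      u ^ k * u′ ^ k   ≈⟨ ^-inverse k uu′≈1 ⟩
      1#               ∎
    as≈b : (w′ + w * ζ) * s ≈ w * ζ′ + w′
    as≈b = u²-equation uu′≈1 u+u′≈x v+v′≈x′
    a≉0 : ¬ w′ + w * ζ ≈ 0#
    a≉0 a≈0 = distinct-unit-ratio i≢i′ ζζ′≈1 a≈0 (trans (sym as≈b) (trans (*-congʳ a≈0) (zeroˡ s)))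
    s-fixed : Fixed s
    s-fixed = fixed-quotient a≉0 as≈b
      (fixed-+ (fixed-∈F (inj₂ (i′ , refl))) (fixed-* (fixed-∈F (inj₂ (i , refl))) (fixed-unity ζ^k≈1)))
      (fixed-+ (fixed-* (fixed-∈F (inj₂ (i , refl))) (fixed-inverse ζζ′≈1 (fixed-unity ζ^k≈1))) (fixed-∈F (inj₂ (i′ , refl))))
    ss′≈1 : s * s′ ≈ 1#
    ss′≈1 = trans (solve 2 (λ u u′ → (u :* u) :* (u′ :* u′) := (u :* u′) :* (u :* u′)) refl u u′)
                  (trans (*-cong uu′≈1 uu′≈1) (*-identityˡ 1#))
    s′-fixed : Fixed s′
    s′-fixed = fixed-inverse ss′≈1 s-fixed
    Y²≈s^k+s′^k : Y * Y ≈ s ^ k + s′ ^ k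
    Y²≈s^k+s′^k = begin
      Y * Y                                ≈⟨ *-cong Y≈u^k+u′^k Y≈u^k+u′^k ⟩
      (u ^ k + u′ ^ k) * (u ^ k + u′ ^ k)  ≈⟨ solve 2 (λ a b → (a :+ b) :* (a :+ b) := a :* a :+ b :* b) refl (u ^ k) (u′ ^ k) ⟩
      u ^ k * u ^ k + u′ ^ k * u′ ^ k      ≈⟨ +-cong (^-distrib-* u u k) (^-distrib-* u′ u′ k) ⟨
      s ^ k + s′ ^ k                       ∎

  factors-disjoint : ∀ i i′ → i ≢ i′ → ∀ {r} → eval (factor i) r ≈ 0# → ¬ eval (factor i′) r ≈ 0#
  factors-disjoint i i′ i≢i′ {r} fᵢ≈0 fᵢ′≈0 = ¬¬-excluded-middle λ
    { (yes v^k+u^k≈0) → aligned-common-zero⇒⊥ i≢i′ uu′≈1 u+u′≈x vv′≈1 v+v′≈x′ Y≈u^k+u′^k (+≈0⇒≈ v^k+u^k≈0)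
    ; (no v^k+u^k≉0)  → aligned-common-zero⇒⊥ i≢i′ (trans (*-comm u′ u) uu′≈1) (trans (+-comm u′ u) u+u′≈x)
                            vv′≈1 v+v′≈x′ (trans Y≈u^k+u′^k (+-comm _ _)) (+≈0⇒≈ (*≈0⇒≈0 v^k+u^k≉0 product≈0)) }
    where
    x x′ u u′ v v′ : A
    x = elems i * r
    x′ = elems i′ * r
    u = proj₁ (∃-u+u⁻¹ x)
    v = proj₁ (∃-u+u⁻¹ x′)
    u′ = x + u
    v′ = x′ + v
    uu′≈1 : u * u′ ≈ 1#
    uu′≈1 = proj₂ (∃-u+u⁻¹ x)
    vv′≈1 : v * v′ ≈ 1#
    vv′≈1 = proj₂ (∃-u+u⁻¹ x′)
    u+u′≈x : u + u′ ≈ x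
    u+u′≈x = solve 2 (λ x u → u :+ (x :+ u) := x) refl x u
    v+v′≈x′ : v + v′ ≈ x′
    v+v′≈x′ = solve 2 (λ x v → v :+ (x :+ v) := x) refl x′ v
    Y≈u^k+u′^k : Y ≈ u ^ k + u′ ^ k
    Y≈u^k+u′^k = factor-zero-split fᵢ≈0 uu′≈1 u+u′≈x
    Y≈v^k+v′^k : Y ≈ v ^ k + v′ ^ k
    Y≈v^k+v′^k = factor-zero-split fᵢ′≈0 vv′≈1 v+v′≈x′
    -- (T + u^k)(T + u′^k) = T² + Y T + 1 also vanishes at T = v^k, as Y = v^k + v′^k.
    product≈0 : (v ^ k + u ^ k) * (v ^ k + u′ ^ k) ≈ 0#
    product≈0 = begin
      (v ^ k + u ^ k) * (v ^ k + u′ ^ k)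
        ≈⟨ solve 3 (λ s t t′ → (s :+ t) :* (s :+ t′) := s :* s :+ s :* (t :+ t′) :+ t :* t′) refl (v ^ k) (u ^ k) (u′ ^ k) ⟩
      v ^ k * v ^ k + v ^ k * (u ^ k + u′ ^ k) + u ^ k * u′ ^ k
        ≈⟨ +-cong (+-congˡ (*-congˡ (trans (sym Y≈u^k+u′^k) Y≈v^k+v′^k))) (^-inverse k uu′≈1) ⟩
      v ^ k * v ^ k + v ^ k * (v ^ k + v′ ^ k) + 1#
        ≈⟨ solve 2 (λ s s′ → s :* s :+ s :* (s :+ s′) :+ I := s :* s′ :+ I) refl (v ^ k) (v′ ^ k) ⟩
      v ^ k * v′ ^ k + 1#
        ≈⟨ +-congʳ (^-inverse k vv′≈1) ⟩
      1# + 1#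
        ≈⟨ 1+1≈0 ⟩
      0# ∎

  dicksonProduct-no-repeated-root : ∀ r → ¬ RepeatedRoot (dicksonProduct fld F k Y) r
  dicksonProduct-no-repeated-root r repeated =
    prodFin-doubleZero (2 ℕ.^ n ℕ.∸ 1) factor r (λ i → factor-simple i r) (λ i i′ i≢i′ → factors-disjoint i i′ i≢i′)
      (repeatedRoot⇒doubleZero (prodFin (2 ℕ.^ n ℕ.∸ 1) factor) r repeated)

open import Data.Nat using (ℕ; _≤_; _^_; _+_; _*_)

lemma2 : ∀ {c ℓ : Level} (L : AlgClosedField c ℓ) →
  let open AlgClosedField L
      open CommutativeRing cring using () renaming (Carrier to A)
      open PolyOps cring using (RepeatedRoot)
  in (n : ℕ) → 1 ≤ n →
     (F : FiniteSubfield fld (2 ^ n)) →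
     (Y : A) → TranscendentalOver fld F Y →
     (k : ℕ) → (∃ λ j → k ≡ 1 + 2 * j) →
     ∀ (r : A) → ¬ RepeatedRoot (dicksonProduct fld F k Y) r
lemma2 L n 1≤n F Y Y-transcendental k (j , ≡.refl) =
  DicksonProduct.dicksonProduct-no-repeated-root L 1≤n F Y Y-transcendental j
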